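{- Let $\rho\ge1$, $k\in\mathbb{N}$, $d=(\rho+2)k+1$, let $D$ be a tournament with $T\subseteq V(D)$, and let $\sigma$ be a regular order of $V(D)$. Then for every maximal non-terminal interval $I$ w.r.t. $\sigma$: $|W_I|\ge|I|-4d$, $|W^-_I|\le 2d$, and $|W^+_I|\le2d$.
   Context: For an order $\sigma=(v_1,\dots,v_n)$, the interval $[v_a,v_b]=\{v_m:a\le m\le b\}$; a non-terminal interval contains no vertex of $T$; it is maximal if it is not a proper subinterval of another non-terminal interval. $N^+_X(v)$, $N^-_X(v)$ denote out-/in-neighbours of $v$ within $X$. $\sigma$ is regular if for every non-terminal interval $I=[v_a,v_b]$, $|N^+_I(v_a)|\ge\lceil(b-a)/2\rceil$ and $|N^-_I(v_b)|\ge\lceil(b-a)/2\rceil$. For a non-terminal $v$ in a maximal non-terminal interval $I$: $v$ is in-rich if $|N^+_I(v)|\le d-1$; out-rich if $|N^-_I(v)|\le d-1$; rich if $|N^+_I(v)|\ge d$ and $|N^-_I(v)|\ge d$. $W_I$, $W^-_I$, $W^+_I$ denote the sets of rich, in-rich and out-rich vertices in $I$, respectively. -}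

module Defs where

open import Data.Nat using (ℕ; zero; suc; _+_; _*_; _∸_; _≤_; _<_; _≤ᵇ_; ⌈_/2⌉)
open import Data.Bool using (Bool; true; false; _∧_; not)
open import Data.Fin using (Fin; toℕ)
open import Data.List using (length; filterᵇ; allFin)
open import Data.Product using (_×_)
open import Relation.Binary.PropositionalEquality using (_≡_; _≢_)
open import Function.Definitions using (Injective)

record Tournament (n : ℕ) : Set where
  field
    arc    : Fin n → Fin n → Bool
    irrefl : ∀ v → arc v v ≡ false
    tourn  : ∀ u v → u ≢ v → arc u v ≡ not (arc v u)
open Tournament public

-- A vertex ordering σ = (v_0, …, v_{n-1}): σ m is the vertex at position m;
-- σ is required to be injective (hence a bijection Fin n → Fin n).
record Order (n : ℕ) : Set where
  field
    at  : Fin n → Fin n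
    inj : Injective _≡_ _≡_ at
open Order public

count : {n : ℕ} → (Fin n → Bool) → ℕ
count {n} p = length (filterᵇ p (allFin n))

module _ {n : ℕ} (D : Tournament n) (Tm : Fin n → Bool) (σ : Order n) where

  inI : Fin n → Fin n → Fin n → Bool
  inI a b m = (toℕ a ≤ᵇ toℕ m) ∧ (toℕ m ≤ᵇ toℕ b)

  outI : Fin n → Fin n → Fin n → ℕ
  outI a b x = count (λ m → inI a b m ∧ arc D (at σ x) (at σ m))

  inNI : Fin n → Fin n → Fin n → ℕ
  inNI a b x = count (λ m → inI a b m ∧ arc D (at σ m) (at σ x))

  NonTerminal : Fin n → Fin n → Set
  NonTerminal a b = toℕ a ≤ toℕ b × (∀ m → toℕ a ≤ toℕ m → toℕ m ≤ toℕ b → Tm (at σ m) ≡ false)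

  MaximalNonTerminal : Fin n → Fin n → Set
  MaximalNonTerminal a b = NonTerminal a b ×
    (∀ a' b' → toℕ a' ≤ toℕ a → toℕ b ≤ toℕ b' → NonTerminal a' b' → (a' ≡ a × b' ≡ b))

  Regular : Set
  Regular = ∀ a b → NonTerminal a b →
    (⌈ (toℕ b ∸ toℕ a) /2⌉ ≤ outI a b a) × (⌈ (toℕ b ∸ toℕ a) /2⌉ ≤ inNI a b b)

  module _ (d : ℕ) where
    inRichᵇ outRichᵇ richᵇ : Fin n → Fin n → Fin n → Bool
    inRichᵇ  a b x = outI a b x ≤ᵇ (d ∸ 1)
    outRichᵇ a b x = inNI a b x ≤ᵇ (d ∸ 1)
    richᵇ    a b x = (d ≤ᵇ outI a b x) ∧ (d ≤ᵇ inNI a b x)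

    #W #W⁻ #W⁺ : Fin n → Fin n → ℕ
    #W  a b = count (λ m → inI a b m ∧ richᵇ a b m)
    #W⁻ a b = count (λ m → inI a b m ∧ inRichᵇ a b m)
    #W⁺ a b = count (λ m → inI a b m ∧ outRichᵇ a b m)

size : {n : ℕ} → Fin n → Fin n → ℕ
size a b = suc (toℕ b ∸ toℕ a)

-- Regularity applied to the suffix [v, v_b] of I gives 2|N⁺_I(v)| ≥ b − pos(v), so an
-- in-rich vertex lies among the last 2d − 1 positions of I; symmetrically (prefixes),
-- out-rich vertices lie among the first 2d − 1. Every vertex of I is rich, in-rich or
-- out-rich, so |I| ≤ |W_I| + 4d.
module Submission where

open import Defs
open import Data.Bool using (Bool; true; false; T; _∧_; _∨_)
open import Data.Bool.Properties using (T-∧; T-∨)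
open import Data.Empty using (⊥-elim)
open import Data.Fin using (Fin; toℕ)
open import Data.Fin.Properties using (toℕ<n)
open import Data.List using ([]; _∷_; [_]; _++_; length; filterᵇ; map; tabulate; allFin; applyUpTo; upTo)
open import Data.List.Properties using (length-++; filter-++; map-tabulate; upTo-∷ʳ)
open import Data.Nat using (ℕ; zero; suc; _+_; _*_; _∸_; _⊓_; _≤_; _<_; _≤ᵇ_; ⌈_/2⌉; ⌊_/2⌋; z≤n; s≤s)
open import Data.Nat.Properties
open import Data.Product using (_×_; _,_; proj₁; proj₂; map₁)
open import Data.Sum using (_⊎_; inj₁; inj₂)
open import Function using (id; _∘_)
open import Function.Bundles using (Equivalence; _⇔_; mk⇔)
open import Relation.Binary.PropositionalEquality using (_≡_; refl; sym; trans; cong; subst; module ≡-Reasoning)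
open import Relation.Nullary using (¬_; yes; no)
open import Relation.Nullary.Decidable using (T?)
open import Relation.Nullary.Reflects using (ofʸ; ofⁿ)

open Equivalence using (to; from)

module _ {A : Set} where

  length-filterᵇ-mono : (p q : A → Bool) → (∀ x → T (p x) → T (q x)) →
    ∀ xs → length (filterᵇ p xs) ≤ length (filterᵇ q xs)
  length-filterᵇ-mono p q p⊆q [] = z≤n
  length-filterᵇ-mono p q p⊆q (x ∷ xs) with p x | q x | p⊆q x
  ... | false | false | _   = length-filterᵇ-mono p q p⊆q xs
  ... | false | true  | _   = m≤n⇒m≤1+n (length-filterᵇ-mono p q p⊆q xs)
  ... | true  | true  | _   = s≤s (length-filterᵇ-mono p q p⊆q xs)
  ... | true  | false | p→q = ⊥-elim (p→q _)

  length-filterᵇ-∨ : (q r : A → Bool) →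
    ∀ xs → length (filterᵇ (λ x → q x ∨ r x) xs) ≤ length (filterᵇ q xs) + length (filterᵇ r xs)
  length-filterᵇ-∨ q r [] = z≤n
  length-filterᵇ-∨ q r (x ∷ xs) with ih ← length-filterᵇ-∨ q r xs | q x | r x
  ... | true  | true  = s≤s (≤-trans ih (+-monoʳ-≤ _ (n≤1+n _)))
  ... | true  | false = s≤s ih
  ... | false | true  = ≤-trans (s≤s ih) (≤-reflexive (sym (+-suc _ _)))
  ... | false | false = ih

  length-filterᵇ-map : {B : Set} (f : A → Bool) (g : B → A) →
    ∀ xs → length (filterᵇ f (map g xs)) ≡ length (filterᵇ (f ∘ g) xs)
  length-filterᵇ-map f g [] = refl
  length-filterᵇ-map f g (x ∷ xs) with f (g x)
  ... | true  = cong suc (length-filterᵇ-map f g xs)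
  ... | false = length-filterᵇ-map f g xs

tabulate-∘-toℕ : {A : Set} (f : ℕ → A) → ∀ n → tabulate {n = n} (f ∘ toℕ) ≡ applyUpTo f n
tabulate-∘-toℕ f zero    = refl
tabulate-∘-toℕ f (suc n) = cong (f 0 ∷_) (tabulate-∘-toℕ (f ∘ suc) n)

between : ℕ → ℕ → ℕ → Bool
between lo hi x = (lo ≤ᵇ x) ∧ (x ≤ᵇ hi)

T-between : ∀ {lo hi x} → T (between lo hi x) ⇔ (lo ≤ x × x ≤ hi)
T-between {lo} {hi} {x} = mk⇔
  (λ t → let (l , h) = to T-∧ t in ≤ᵇ⇒≤ lo x l , ≤ᵇ⇒≤ x hi h)
  (λ (l , h) → from T-∧ (≤⇒≤ᵇ l , ≤⇒≤ᵇ h))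

length-filterᵇ-between-step : ∀ lo hi n →
  n ⊓ suc hi ∸ lo + length (filterᵇ (between lo hi) [ n ]) ≡ suc n ⊓ suc hi ∸ lo
length-filterᵇ-between-step lo hi n with lo ≤ᵇ n | ≤ᵇ-reflects-≤ lo n | n ≤ᵇ hi | ≤ᵇ-reflects-≤ n hi
... | true | ofʸ lo≤n | true | ofʸ n≤hi = begin
  n ⊓ suc hi ∸ lo + 1     ≡⟨ cong (λ m → m ∸ lo + 1) (m≤n⇒m⊓n≡m (m≤n⇒m≤1+n n≤hi)) ⟩
  n ∸ lo + 1              ≡⟨ +-comm (n ∸ lo) 1 ⟩
  suc (n ∸ lo)            ≡⟨ sym (+-∸-assoc 1 lo≤n) ⟩
  suc n ∸ lo              ≡⟨ cong (λ m → suc m ∸ lo) (sym (m≤n⇒m⊓n≡m n≤hi)) ⟩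
  suc (n ⊓ hi) ∸ lo       ∎
  where open ≡-Reasoning
... | true | ofʸ _ | false | ofⁿ n≰hi = begin
  n ⊓ suc hi ∸ lo + 0     ≡⟨ +-identityʳ _ ⟩
  n ⊓ suc hi ∸ lo         ≡⟨ cong (_∸ lo) (m≥n⇒m⊓n≡n hi<n) ⟩
  suc hi ∸ lo             ≡⟨ cong (λ m → suc m ∸ lo) (sym (m≥n⇒m⊓n≡n (<⇒≤ hi<n))) ⟩
  suc (n ⊓ hi) ∸ lo       ∎
  where
  open ≡-Reasoning
  hi<n : hi < n
  hi<n = ≰⇒> n≰hi
... | false | ofⁿ lo≰n | _ | _ = trans (+-identityʳ _) (trans (m≤n⇒m∸n≡0 before) (sym (m≤n⇒m∸n≡0 before′)))
  where
  before : n ⊓ suc hi ≤ lo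
  before = ≤-trans (m⊓n≤m n (suc hi)) (<⇒≤ (≰⇒> lo≰n))
  before′ : suc n ⊓ suc hi ≤ lo
  before′ = ≤-trans (m⊓n≤m (suc n) (suc hi)) (≰⇒> lo≰n)

length-filterᵇ-between-upTo : ∀ lo hi n → length (filterᵇ (between lo hi) (upTo n)) ≡ n ⊓ suc hi ∸ lo
length-filterᵇ-between-upTo lo hi zero    = sym (0∸n≡0 lo)
length-filterᵇ-between-upTo lo hi (suc n) = begin
  length (filterᵇ p (upTo (suc n)))                  ≡⟨ cong (length ∘ filterᵇ p) (sym (upTo-∷ʳ n)) ⟩
  length (filterᵇ p (upTo n ++ [ n ]))               ≡⟨ cong length (filter-++ (T? ∘ p) (upTo n) [ n ]) ⟩
  length (filterᵇ p (upTo n) ++ filterᵇ p [ n ])     ≡⟨ length-++ (filterᵇ p (upTo n)) ⟩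
  length (filterᵇ p (upTo n)) + length (filterᵇ p [ n ])
    ≡⟨ cong (_+ length (filterᵇ p [ n ])) (length-filterᵇ-between-upTo lo hi n) ⟩
  n ⊓ suc hi ∸ lo + length (filterᵇ p [ n ])         ≡⟨ length-filterᵇ-between-step lo hi n ⟩
  suc n ⊓ suc hi ∸ lo                                ∎
  where
  open ≡-Reasoning
  p : ℕ → Bool
  p = between lo hi

module _ {n : ℕ} where

  count-mono : (p q : Fin n → Bool) → (∀ i → T (p i) → T (q i)) → count p ≤ count q
  count-mono p q p⊆q = length-filterᵇ-mono p q p⊆q (allFin n)

  count-∨ : (p q : Fin n → Bool) → count (λ i → p i ∨ q i) ≤ count p + count q
  count-∨ p q = length-filterᵇ-∨ p q (allFin n)

  count-∘-toℕ : (f : ℕ → Bool) → count {n} (f ∘ toℕ) ≡ length (filterᵇ f (upTo n))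
  count-∘-toℕ f = begin
    length (filterᵇ (f ∘ toℕ) (allFin n))    ≡⟨ sym (length-filterᵇ-map f toℕ (allFin n)) ⟩
    length (filterᵇ f (map toℕ (allFin n)))  ≡⟨ cong (length ∘ filterᵇ f) (map-tabulate {n = n} id toℕ) ⟩
    length (filterᵇ f (tabulate {n = n} toℕ)) ≡⟨ cong (length ∘ filterᵇ f) (tabulate-∘-toℕ id n) ⟩
    length (filterᵇ f (upTo n))              ∎
    where open ≡-Reasoning

  count-between : ∀ lo hi → count {n} (between lo hi ∘ toℕ) ≡ n ⊓ suc hi ∸ lo
  count-between lo hi = trans (count-∘-toℕ (between lo hi)) (length-filterᵇ-between-upTo lo hi n)

  count-⊆-between : ∀ {lo hi} (p : Fin n → Bool) → (∀ i → T (p i) → lo ≤ toℕ i × toℕ i ≤ hi) →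
    count p ≤ suc hi ∸ lo
  count-⊆-between {lo} {hi} p p⊆[lo,hi] = begin
    count p                          ≤⟨ count-mono p (between lo hi ∘ toℕ {n}) (λ i → from T-between ∘ p⊆[lo,hi] i) ⟩
    count {n} (between lo hi ∘ toℕ)  ≡⟨ count-between lo hi ⟩
    n ⊓ suc hi ∸ lo                  ≤⟨ ∸-monoˡ-≤ lo (m⊓n≤n n (suc hi)) ⟩
    suc hi ∸ lo                      ∎
    where open ≤-Reasoning

m≤2*⌈m/2⌉ : ∀ m → m ≤ 2 * ⌈ m /2⌉
m≤2*⌈m/2⌉ m = begin
  m                        ≡⟨ sym (⌊n/2⌋+⌈n/2⌉≡n m) ⟩
  ⌊ m /2⌋ + ⌈ m /2⌉        ≤⟨ +-monoˡ-≤ ⌈ m /2⌉ (⌊n/2⌋≤⌈n/2⌉ m) ⟩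
  ⌈ m /2⌉ + ⌈ m /2⌉        ≡⟨ cong (⌈ m /2⌉ +_) (sym (+-identityʳ ⌈ m /2⌉)) ⟩
  2 * ⌈ m /2⌉              ∎
  where open ≤-Reasoning

m∸n≤o⇒m∸o≤n : ∀ m n o → m ∸ n ≤ o → m ∸ o ≤ n
m∸n≤o⇒m∸o≤n m n o m∸n≤o = m≤n+o⇒m∸n≤o m o (begin
  m            ≤⟨ m≤n+m∸n m n ⟩
  n + (m ∸ n)  ≤⟨ +-monoʳ-≤ n m∸n≤o ⟩
  n + o        ≡⟨ +-comm n o ⟩
  o + n        ∎)
  where open ≤-Reasoning

1+2*[n∸1]≤2*n : ∀ {n} → 1 ≤ n → suc (2 * (n ∸ 1)) ≤ 2 * n
1+2*[n∸1]≤2*n {suc m} _ = s≤s (+-monoʳ-≤ m (n≤1+n (m + 0)))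

∧-monoˡ-T : ∀ {x y z} → (T x → T y) → T (x ∧ z) → T (y ∧ z)
∧-monoˡ-T x⇒y = from T-∧ ∘ map₁ x⇒y ∘ to T-∧

module _ {n : ℕ} (D : Tournament n) (Tm : Fin n → Bool) (σ : Order n) where

  inI-⊆ : ∀ {a b a′ b′} → toℕ a′ ≤ toℕ a → toℕ b ≤ toℕ b′ →
    ∀ m → T (inI D Tm σ a b m) → T (inI D Tm σ a′ b′ m)
  inI-⊆ a′≤a b≤b′ m m∈I =
    let (a≤m , m≤b) = to T-between m∈I in from T-between (≤-trans a′≤a a≤m , ≤-trans m≤b b≤b′)

  outI-mono : ∀ {a b a′ b′} x → toℕ a′ ≤ toℕ a → toℕ b ≤ toℕ b′ →
    outI D Tm σ a b x ≤ outI D Tm σ a′ b′ x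
  outI-mono x a′≤a b≤b′ = count-mono _ _ (λ m → ∧-monoˡ-T (inI-⊆ a′≤a b≤b′ m))

  inNI-mono : ∀ {a b a′ b′} x → toℕ a′ ≤ toℕ a → toℕ b ≤ toℕ b′ →
    inNI D Tm σ a b x ≤ inNI D Tm σ a′ b′ x
  inNI-mono x a′≤a b≤b′ = count-mono _ _ (λ m → ∧-monoˡ-T (inI-⊆ a′≤a b≤b′ m))

  NonTerminal-⊆ : ∀ {a b a′ b′} → NonTerminal D Tm σ a′ b′ →
    toℕ a′ ≤ toℕ a → toℕ a ≤ toℕ b → toℕ b ≤ toℕ b′ → NonTerminal D Tm σ a b
  NonTerminal-⊆ (_ , noT) a′≤a a≤b b≤b′ =
    a≤b , λ m a≤m m≤b → noT m (≤-trans a′≤a a≤m) (≤-trans m≤b b≤b′)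

  size≡count-inI : ∀ {a b} → toℕ a ≤ toℕ b → size a b ≡ count (inI D Tm σ a b)
  size≡count-inI {a} {b} a≤b = begin
    suc (toℕ b ∸ toℕ a)            ≡⟨ sym (+-∸-assoc 1 a≤b) ⟩
    suc (toℕ b) ∸ toℕ a            ≡⟨ cong (_∸ toℕ a) (sym (m≥n⇒m⊓n≡n (toℕ<n b))) ⟩
    n ⊓ suc (toℕ b) ∸ toℕ a        ≡⟨ sym (count-between (toℕ a) (toℕ b)) ⟩
    count (inI D Tm σ a b)         ∎
    where open ≡-Reasoning

  module _ (d : ℕ) (a b : Fin n) where

    rich⊎inRich⊎outRich : ∀ x →
      T (richᵇ D Tm σ d a b x) ⊎ T (inRichᵇ D Tm σ d a b x) ⊎ T (outRichᵇ D Tm σ d a b x)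
    rich⊎inRich⊎outRich x with outI D Tm σ a b x ≤? d ∸ 1 | inNI D Tm σ a b x ≤? d ∸ 1
    ... | yes out≤ | _        = inj₂ (inj₁ (≤⇒≤ᵇ out≤))
    ... | no _     | yes in≤  = inj₂ (inj₂ (≤⇒≤ᵇ in≤))
    ... | no out≰  | no in≰   = inj₁ (from T-∧ (≤⇒≤ᵇ (above out≰) , ≤⇒≤ᵇ (above in≰)))
      where
      above : ∀ {m} → ¬ m ≤ d ∸ 1 → d ≤ m
      above m≰ = ≤-trans (m≤n+m∸n d 1) (≰⇒> m≰)

    count-inI≤#W+#W⁻+#W⁺ :
      count (inI D Tm σ a b) ≤ #W D Tm σ d a b + (#W⁻ D Tm σ d a b + #W⁺ D Tm σ d a b)
    count-inI≤#W+#W⁻+#W⁺ = begin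
      count I                                  ≤⟨ count-mono I (λ m → W m ∨ (W⁻ m ∨ W⁺ m)) classify ⟩
      count (λ m → W m ∨ (W⁻ m ∨ W⁺ m))       ≤⟨ count-∨ W (λ m → W⁻ m ∨ W⁺ m) ⟩
      count W + count (λ m → W⁻ m ∨ W⁺ m)     ≤⟨ +-monoʳ-≤ (count W) (count-∨ W⁻ W⁺) ⟩
      count W + (count W⁻ + count W⁺)         ∎
      where
      open ≤-Reasoning
      I W W⁻ W⁺ : Fin n → Bool
      I  = inI D Tm σ a b
      W  m = I m ∧ richᵇ D Tm σ d a b m
      W⁻ m = I m ∧ inRichᵇ D Tm σ d a b m
      W⁺ m = I m ∧ outRichᵇ D Tm σ d a b m
      classify : ∀ m → T (I m) → T (W m ∨ (W⁻ m ∨ W⁺ m))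
      classify m m∈I with rich⊎inRich⊎outRich m
      ... | inj₁ rich           = from (T-∨ {W m}) (inj₁ (from T-∧ (m∈I , rich)))
      ... | inj₂ (inj₁ inRich)  = from (T-∨ {W m}) (inj₂ (from (T-∨ {W⁻ m}) (inj₁ (from T-∧ (m∈I , inRich)))))
      ... | inj₂ (inj₂ outRich) = from (T-∨ {W m}) (inj₂ (from (T-∨ {W⁻ m}) (inj₂ (from T-∧ (m∈I , outRich)))))

  module _ (regular : Regular D Tm σ) {a b : Fin n} (I : NonTerminal D Tm σ a b) (d : ℕ) where

    inI-bounds : ∀ x → T (inI D Tm σ a b x) → toℕ a ≤ toℕ x × toℕ x ≤ toℕ b
    inI-bounds x = to T-between

    inRich⇒near-end : ∀ x → T (inI D Tm σ a b x) → T (inRichᵇ D Tm σ d a b x) →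
      toℕ b ∸ toℕ x ≤ 2 * (d ∸ 1)
    inRich⇒near-end x x∈I inRich = begin
      toℕ b ∸ toℕ x                ≤⟨ m≤2*⌈m/2⌉ _ ⟩
      2 * ⌈ (toℕ b ∸ toℕ x) /2⌉    ≤⟨ *-monoʳ-≤ 2 (proj₁ (regular x b suffix)) ⟩
      2 * outI D Tm σ x b x        ≤⟨ *-monoʳ-≤ 2 (outI-mono {x} {b} {a} {b} x a≤x ≤-refl) ⟩
      2 * outI D Tm σ a b x        ≤⟨ *-monoʳ-≤ 2 (≤ᵇ⇒≤ (outI D Tm σ a b x) (d ∸ 1) inRich) ⟩
      2 * (d ∸ 1)                  ∎
      where
      open ≤-Reasoning
      a≤x : toℕ a ≤ toℕ x
      a≤x = proj₁ (inI-bounds x x∈I)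
      suffix : NonTerminal D Tm σ x b
      suffix = NonTerminal-⊆ I a≤x (proj₂ (inI-bounds x x∈I)) ≤-refl

    outRich⇒near-start : ∀ x → T (inI D Tm σ a b x) → T (outRichᵇ D Tm σ d a b x) →
      toℕ x ∸ toℕ a ≤ 2 * (d ∸ 1)
    outRich⇒near-start x x∈I outRich = begin
      toℕ x ∸ toℕ a                ≤⟨ m≤2*⌈m/2⌉ _ ⟩
      2 * ⌈ (toℕ x ∸ toℕ a) /2⌉    ≤⟨ *-monoʳ-≤ 2 (proj₂ (regular a x prefix)) ⟩
      2 * inNI D Tm σ a x x        ≤⟨ *-monoʳ-≤ 2 (inNI-mono {a} {x} {a} {b} x ≤-refl x≤b) ⟩
      2 * inNI D Tm σ a b x        ≤⟨ *-monoʳ-≤ 2 (≤ᵇ⇒≤ (inNI D Tm σ a b x) (d ∸ 1) outRich) ⟩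
      2 * (d ∸ 1)                  ∎
      where
      open ≤-Reasoning
      x≤b : toℕ x ≤ toℕ b
      x≤b = proj₂ (inI-bounds x x∈I)
      prefix : NonTerminal D Tm σ a x
      prefix = NonTerminal-⊆ I ≤-refl (proj₁ (inI-bounds x x∈I)) x≤b

    #W⁻≤1+2*[d∸1] : #W⁻ D Tm σ d a b ≤ suc (2 * (d ∸ 1))
    #W⁻≤1+2*[d∸1] = ≤-trans (count-⊆-between _ in-window) (≤-reflexive (m+n∸n≡m (suc c) (toℕ b ∸ c)))
      where
      c : ℕ
      c = 2 * (d ∸ 1)
      in-window : ∀ x → T (inI D Tm σ a b x ∧ inRichᵇ D Tm σ d a b x) →
        toℕ b ∸ c ≤ toℕ x × toℕ x ≤ c + (toℕ b ∸ c)
      in-window x x∈W⁻ with x∈I , inRich ← to (T-∧ {inI D Tm σ a b x}) x∈W⁻ =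
          m∸n≤o⇒m∸o≤n _ _ _ (inRich⇒near-end x x∈I inRich)
        , ≤-trans (proj₂ (inI-bounds x x∈I)) (m≤n+m∸n (toℕ b) c)

    #W⁺≤1+2*[d∸1] : #W⁺ D Tm σ d a b ≤ suc (2 * (d ∸ 1))
    #W⁺≤1+2*[d∸1] = ≤-trans (count-⊆-between _ in-window) (≤-reflexive (m+n∸n≡m (suc c) (toℕ a)))
      where
      c : ℕ
      c = 2 * (d ∸ 1)
      in-window : ∀ x → T (inI D Tm σ a b x ∧ outRichᵇ D Tm σ d a b x) →
        toℕ a ≤ toℕ x × toℕ x ≤ c + toℕ a
      in-window x x∈W⁺ with x∈I , outRich ← to (T-∧ {inI D Tm σ a b x}) x∈W⁺ =
        proj₁ (inI-bounds x x∈I) , (begin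
        toℕ x                      ≤⟨ m≤n+m∸n (toℕ x) (toℕ a) ⟩
        toℕ a + (toℕ x ∸ toℕ a)    ≤⟨ +-monoʳ-≤ (toℕ a) (outRich⇒near-start x x∈I outRich) ⟩
        toℕ a + c                  ≡⟨ +-comm (toℕ a) c ⟩
        c + toℕ a                  ∎)
        where open ≤-Reasoning

lemma5 : (ρ k : ℕ) → 1 ≤ ρ → (d : ℕ) → d ≡ (ρ + 2) * k + 1 →
    {n : ℕ} (D : Tournament n) (Tm : Fin n → Bool) (σ : Order n) →
    Regular D Tm σ →
    ∀ a b → MaximalNonTerminal D Tm σ a b →
      (size a b ∸ 4 * d ≤ #W D Tm σ d a b)
      × (#W⁻ D Tm σ d a b ≤ 2 * d)
      × (#W⁺ D Tm σ d a b ≤ 2 * d)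
lemma5 ρ k _ d d≡ D Tm σ regular a b (I , _) =
  m≤n+o⇒m∸n≤o (size a b) (4 * d) size≤4d+#W , #W⁻≤2d , #W⁺≤2d
  where
  1≤d : 1 ≤ d
  1≤d = subst (1 ≤_) (sym d≡) (m≤n+m 1 ((ρ + 2) * k))
  #W⁻≤2d : #W⁻ D Tm σ d a b ≤ 2 * d
  #W⁻≤2d = ≤-trans (#W⁻≤1+2*[d∸1] D Tm σ regular I d) (1+2*[n∸1]≤2*n 1≤d)
  #W⁺≤2d : #W⁺ D Tm σ d a b ≤ 2 * d
  #W⁺≤2d = ≤-trans (#W⁺≤1+2*[d∸1] D Tm σ regular I d) (1+2*[n∸1]≤2*n 1≤d)
  size≤4d+#W : size a b ≤ 4 * d + #W D Tm σ d a b
  size≤4d+#W = begin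
    size a b                                                 ≡⟨ size≡count-inI D Tm σ (proj₁ I) ⟩
    count (inI D Tm σ a b)                                   ≤⟨ count-inI≤#W+#W⁻+#W⁺ D Tm σ d a b ⟩
    #W D Tm σ d a b + (#W⁻ D Tm σ d a b + #W⁺ D Tm σ d a b)
      ≤⟨ +-monoʳ-≤ (#W D Tm σ d a b) (+-mono-≤ #W⁻≤2d #W⁺≤2d) ⟩
    #W D Tm σ d a b + (2 * d + 2 * d)                        ≡⟨ cong (#W D Tm σ d a b +_) (sym (*-distribʳ-+ d 2 2)) ⟩
    #W D Tm σ d a b + 4 * d                                  ≡⟨ +-comm (#W D Tm σ d a b) (4 * d) ⟩
    4 * d + #W D Tm σ d a b                                  ∎
    where open ≤-Reasoning
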